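{- Let $f$ be the morphism on $\{\mathtt{0},\ldots,\mathtt{4}\}^*$ with $f(\mathtt{0})=\mathtt{01203}$, $f(\mathtt{1})=\mathtt{0124}$, $f(\mathtt{2})=\mathtt{0120323}$, $f(\mathtt{3})=\mathtt{01240324}$, $f(\mathtt{4})=\mathtt{01240323}$, and $g:\{\mathtt{0},\ldots,\mathtt{4}\}^*\to\{\mathtt{a},\mathtt{b},\mathtt{c},\mathtt{d},\mathtt{e}\}^*$ the morphism with $g(\mathtt{0})=\mathtt{abcdeacd}$, $g(\mathtt{1})=\mathtt{abcdbecd}$, $g(\mathtt{2})=\mathtt{abcdeacdbe}$, $g(\mathtt{3})=\mathtt{abcdbecdeacdbecd}$, $g(\mathtt{4})=\mathtt{abcdbecdeacdbe}$, and let $w_5=g(f^\omega(\mathtt{0}))$. For $d\ge 0$ let $p_{\mathtt{01203}}=\mathtt{d}\,g(\mathtt{3}\,f(\mathtt{3})\cdots f^{d-1}(\mathtt{3})\,f^d(\mathtt{3}))$ and $s_{\mathtt{01203}}=g(f^d(\mathtt{012})\,f^{d-1}(\mathtt{012})\cdots f(\mathtt{012})\,\mathtt{012})\,\mathtt{abcdeac}$. Then for every $d\ge 0$, the word $T_{\mathtt{01203}}=p_{\mathtt{01203}}s_{\mathtt{01203}}$ is a conjugate of $g(f^d(\mathtt{01203}))$ that is not a factor of $w_5$.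
   Context: $f^\omega(\mathtt{0})$ is the infinite fixed point of $f$ starting with $\mathtt{0}$. A conjugate of a word $xy$ is $yx$. -}

module Defs where

open import Data.Nat using (ℕ; zero; suc; _+_; _<_)
open import Data.List using (List; []; _∷_; _++_; concatMap; map; length; upTo)
open import Data.Product using (Σ; _×_; ∃)
open import Relation.Binary.PropositionalEquality using (_≡_)

data D : Set where
  𝟎 𝟏 𝟐 𝟑 𝟒 : D

data L : Set where
  a b c d e : L

morph : {A B : Set} → (A → List B) → List A → List B
morph h = concatMap h

iter : {A : Set} → ℕ → (List A → List A) → List A → List A
iter zero    h w = w
iter (suc n) h w = h (iter n h w)

f₁ : D → List D
f₁ 𝟎 = 𝟎 ∷ 𝟏 ∷ 𝟐 ∷ 𝟎 ∷ 𝟑 ∷ []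
f₁ 𝟏 = 𝟎 ∷ 𝟏 ∷ 𝟐 ∷ 𝟒 ∷ []
f₁ 𝟐 = 𝟎 ∷ 𝟏 ∷ 𝟐 ∷ 𝟎 ∷ 𝟑 ∷ 𝟐 ∷ 𝟑 ∷ []
f₁ 𝟑 = 𝟎 ∷ 𝟏 ∷ 𝟐 ∷ 𝟒 ∷ 𝟎 ∷ 𝟑 ∷ 𝟐 ∷ 𝟒 ∷ []
f₁ 𝟒 = 𝟎 ∷ 𝟏 ∷ 𝟐 ∷ 𝟒 ∷ 𝟎 ∷ 𝟑 ∷ 𝟐 ∷ 𝟑 ∷ []

g₁ : D → List L
g₁ 𝟎 = a ∷ b ∷ c ∷ d ∷ e ∷ a ∷ c ∷ d ∷ []
g₁ 𝟏 = a ∷ b ∷ c ∷ d ∷ b ∷ e ∷ c ∷ d ∷ []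
g₁ 𝟐 = a ∷ b ∷ c ∷ d ∷ e ∷ a ∷ c ∷ d ∷ b ∷ e ∷ []
g₁ 𝟑 = a ∷ b ∷ c ∷ d ∷ b ∷ e ∷ c ∷ d ∷ e ∷ a ∷ c ∷ d ∷ b ∷ e ∷ c ∷ d ∷ []
g₁ 𝟒 = a ∷ b ∷ c ∷ d ∷ b ∷ e ∷ c ∷ d ∷ e ∷ a ∷ c ∷ d ∷ b ∷ e ∷ []

f : List D → List D
f = morph f₁

g : List D → List L
g = morph g₁

fpow : ℕ → List D → List D
fpow n = iter n f

lookupD : {A : Set} → A → List A → ℕ → A
lookupD x []       _       = x
lookupD x (y ∷ ys) zero    = y
lookupD x (y ∷ ys) (suc n) = lookupD x ys n

-- Infinite words are maps ℕ → A.
-- f^ω(0): f(0) begins with 0 and |f^(n+1)(0)| ≥ n+1, so f^(n+1)(0) is a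
-- prefix of f^ω(0) of length > n; its n-th letter is the n-th letter of f^ω(0).
fω : ℕ → D
fω n = lookupD 𝟎 (fpow (suc n) (𝟎 ∷ [])) n

prefix : {A : Set} → (ℕ → A) → ℕ → List A
prefix x n = map x (upTo n)

-- image of an infinite word under the non-erasing morphism g:
-- the n-th letter of g(x) is the n-th letter of g(x[0..n]) (|g(x[0..n])| ≥ n+1)
gω : (ℕ → D) → ℕ → L
gω x n = lookupD a (g (prefix x (suc n))) n

w₅ : ℕ → L
w₅ = gω fω

FactorOf : {A : Set} → List A → (ℕ → A) → Set
FactorOf u w = ∃ λ i → prefix (λ j → w (i + j)) (length u) ≡ u

Conjugate : {A : Set} → List A → List A → Set
Conjugate u v = ∃ λ x → ∃ λ y → (v ≡ x ++ y) × (u ≡ y ++ x)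

pWord : ℕ → List D
pWord zero    = fpow 0 (𝟑 ∷ [])
pWord (suc k) = pWord k ++ fpow (suc k) (𝟑 ∷ [])

sWord : ℕ → List D
sWord zero    = fpow 0 (𝟎 ∷ 𝟏 ∷ 𝟐 ∷ [])
sWord (suc k) = fpow (suc k) (𝟎 ∷ 𝟏 ∷ 𝟐 ∷ []) ++ sWord k

p01203 : ℕ → List L
p01203 k = d ∷ g (pWord k)

s01203 : ℕ → List L
s01203 k = g (sWord k) ++ (a ∷ b ∷ c ∷ d ∷ e ∷ a ∷ c ∷ [])

T01203 : ℕ → List L
T01203 k = p01203 k ++ s01203 k

module Submission where

open import Defs
open import Data.Nat using (ℕ; zero; suc; _+_; _*_; _≤_; _<_; _≤′_; ≤′-refl; ≤′-step; z≤n; s≤s; z<s; s<s)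
import Data.Nat as ℕ
open import Data.Nat.Properties
open import Data.List using (List; []; _∷_; _++_; _∷ʳ_; length; drop; reverse; concatMap; applyUpTo; upTo; map; initLast; _∷ʳ′_)
open import Data.List.Properties
  using (++-monoid; ++-assoc; ++-identityʳ; ++-conicalˡ; ++-conicalʳ; ∷-injective; length-++; concatMap-++; reverse-++; map-upTo; length-applyUpTo)
open import Data.List.Relation.Binary.Prefix.Heterogeneous.Properties using (prefix?; length-mono)
open import Data.List.Relation.Unary.Linked as Linked using (Linked; []; [-]; _∷_)
open import Data.Product using (∃; ∃₂; _×_; _,_)
open import Data.Sum using (_⊎_; inj₁; inj₂)
open import Data.Empty using (⊥; ⊥-elim)
open import Data.Unit using (⊤)
open import Function using (_∘_; Injective; StrictlyInverseʳ)
open import Function.Consequences.Propositional using (inverseʳ⇒injective; strictlyInverseʳ⇒inverseʳ)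
open import Function.Bundles using (mk↣)
open import Relation.Binary.Core using (Rel)
open import Relation.Binary.Definitions using (Decidable; DecidableEquality)
open import Relation.Binary.PropositionalEquality
open import Relation.Nullary using (¬_)
open import Relation.Nullary.Decidable using (map′; False; toWitnessFalse; via-injection)

-- Both f and g are synchronizing: 01 (resp. abcd) begins every f-block (resp. g-block) and
-- occurs in f(Y)01 (resp. g(Y)abcd) only at block boundaries, and f, g are injective on
-- letters, so occurrences of image words can be desubstituted. Put Tpre 0 = [] and
-- Tpre (k+1) = 3 f(Tpre k) 012, so that T01203 k = d g(Tpre (k+1)) abcdeac. An occurrence
-- of T01203 k in g(f^(k+2)(Y)) desubstitutes to an occurrence of x Tpre(k+1) z in f^(k+2)(Y)
-- with x ≠ 2 (only g(2) does not end in d) and z ∈ {0,2} (only g(0), g(2) begin with abcde).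
-- Each f-desubstitution turns x Tpre(j+1) z into 0 Tpre(j) z' with z' ∈ {0,2}, because only
-- f(0) ends in x3 with x ≠ 2 and only f(0), f(2) begin with 0120. After k+1 steps this gives
-- a factor 0z of an f-image with z ∈ {0,2}, but in f-images 0 is only followed by 1 or 3.
-- Finally every prefix of w₅ is a prefix of g(f^N(0)) for all large N.

module _ {A : Set} where

  -- In the free monoid, u ∣ˡ w and u ∣ʳ w say that u is a prefix, resp. a suffix, of w.
  open import Algebra.Properties.Monoid.Divisibility (++-monoid A) public
  open import Data.List.Relation.Binary.Prefix.Propositional.Properties {A = A} public

  ++-equidivisible : ∀ (xs ys us ws : List A) → xs ++ ys ≡ us ++ ws →
    (∃ λ v → us ≡ xs ++ v × ys ≡ v ++ ws) ⊎ (∃₂ λ z v → xs ≡ us ++ z ∷ v × z ∷ v ++ ys ≡ ws)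
  ++-equidivisible [] ys us ws eq = inj₁ (us , refl , eq)
  ++-equidivisible (x ∷ xs) ys [] ws eq = inj₂ (x , xs , refl , eq)
  ++-equidivisible (x ∷ xs) ys (u ∷ us) ws eq with ∷-injective eq
  ... | refl , eq′ with ++-equidivisible xs ys us ws eq′
  ...   | inj₁ (v , us≡ , ys≡) = inj₁ (v , cong (x ∷_) us≡ , ys≡)
  ...   | inj₂ (z , v , xs≡ , ws≡) = inj₂ (z , v , cong (x ∷_) xs≡ , ws≡)

  length-suffix : ∀ (us ws : List A) → length ws ≤ length (us ++ ws)
  length-suffix us ws = ≤-trans (m≤n+m (length ws) (length us)) (≤-reflexive (sym (length-++ us)))

  length-∣ˡ : ∀ {p w : List A} → p ∣ˡ w → length p ≤ length w
  length-∣ˡ = length-mono ∘ ∣ˡ-as-Prefix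

  ∣ˡ-by-length : ∀ {p q w : List A} → p ∣ˡ w → q ∣ˡ w → length p ≤ length q → p ∣ˡ q
  ∣ˡ-by-length {[]} {q} _ _ _ = ε∣ˡ q
  ∣ˡ-by-length {x ∷ p} {y ∷ q} (r , refl) (s , eq) (s≤s p≤q) with ∷-injective eq
  ... | refl , eq′ = x∣ˡy⇒zx∣ˡzy (x ∷ []) (∣ˡ-by-length (r , refl) (s , eq′) p≤q)

  ∣ʳ-by-length : ∀ (xs ys us ws : List A) → xs ++ ys ≡ us ++ ws → length ws ≤ length ys → ws ∣ʳ ys
  ∣ʳ-by-length xs ys us ws eq ws≤ys with ++-equidivisible xs ys us ws eq
  ... | inj₁ (v , _ , ys≡) = v , sym ys≡
  ... | inj₂ (z , v , _ , refl) = ⊥-elim (<⇒≱ (s≤s (length-suffix v ys)) ws≤ys)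

  ∣ʳ⇒reverse-∣ˡ : ∀ {t w : List A} → t ∣ʳ w → reverse t ∣ˡ reverse w
  ∣ʳ⇒reverse-∣ˡ {t} (q , refl) = reverse q , sym (reverse-++ q t)

  lookupD-∣ˡ : ∀ (z : A) {p w} i → i < length p → p ∣ˡ w → lookupD z w i ≡ lookupD z p i
  lookupD-∣ˡ z {x ∷ p} zero _ (_ , refl) = refl
  lookupD-∣ˡ z {x ∷ p} (suc i) (s≤s i<p) (q , refl) = lookupD-∣ˡ z {p} i i<p (q , refl)

  applyUpTo-∣ˡ : ∀ (z : A) (x : ℕ → A) n W → n ≤ length W →
    (∀ {j} → j < n → x j ≡ lookupD z W j) → applyUpTo x n ∣ˡ W
  applyUpTo-∣ˡ z x zero W _ _ = ε∣ˡ W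
  applyUpTo-∣ˡ z x (suc n) (w ∷ W) (s≤s n≤W) agree with agree z<s
  ... | refl = x∣ˡy⇒zx∣ˡzy (w ∷ []) (applyUpTo-∣ˡ z (x ∘ suc) n W n≤W (agree ∘ s<s))

  applyUpTo-+ : ∀ (x : ℕ → A) m n → applyUpTo x (m + n) ≡ applyUpTo x m ++ applyUpTo (λ j → x (m + j)) n
  applyUpTo-+ x zero n = refl
  applyUpTo-+ x (suc m) n = cong (x 0 ∷_) (applyUpTo-+ (x ∘ suc) m n)

  factor⇒suffix-of-prefix : ∀ {u : List A} {x} → FactorOf u x → ∃₂ λ n U → applyUpTo x n ≡ U ++ u
  factor⇒suffix-of-prefix {u} {x} (i , occ) =
    i + length u , applyUpTo x i ,
    trans (applyUpTo-+ x i (length u)) (cong (applyUpTo x i ++_) (trans (sym (map-upTo _ (length u))) occ))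

  Linked-drop : ∀ {ℓ} {R : Rel A ℓ} U {w} → Linked R (U ++ w) → Linked R w
  Linked-drop [] lw = lw
  Linked-drop (_ ∷ U) lw = Linked-drop U (Linked.tail lw)

concatMap-∣ˡ : ∀ {A B : Set} (h : A → List B) {p w : List A} → p ∣ˡ w → concatMap h p ∣ˡ concatMap h w
concatMap-∣ˡ h {p} (q , refl) = concatMap h q , sym (concatMap-++ h p q)

module _ {B : Set} (_≟_ : DecidableEquality B) where

  _∣ˡ?_ : Decidable (_∣ˡ_ {B})
  p ∣ˡ? w = map′ Prefix-as-∣ˡ ∣ˡ-as-Prefix (prefix? _≟_ p w)

  NoMarkerInside : List B → List B → Set
  NoMarkerInside m [] = ⊤
  NoMarkerInside m (z ∷ s) = False (m ∣ˡ? (z ∷ s ++ m)) × NoMarkerInside m s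

  no-marker-inside : ∀ {m t} u {z s} → NoMarkerInside m t → t ≡ u ++ z ∷ s → ¬ m ∣ˡ (z ∷ s ++ m)
  no-marker-inside [] (m∤ , _) refl = toWitnessFalse m∤
  no-marker-inside (_ ∷ u) (_ , rest) refl = no-marker-inside u rest refl

module Synchronizing {A B : Set} (h : A → List B) (m : List B) (m≢[] : m ≢ [])
  (m∣ˡh : ∀ x → m ∣ˡ h x)
  (m-only-at-cuts : ∀ {x y u z s} → h x ≡ y ∷ u ++ z ∷ s → ¬ m ∣ˡ (z ∷ s ++ m))
  (h-injective : Injective _≡_ _≡_ h) where

  H : List A → List B
  H = concatMap h

  H-∷ʳ : ∀ Y x → H (Y ∷ʳ x) ≡ H Y ++ h x
  H-∷ʳ Y x = trans (concatMap-++ h Y (x ∷ [])) (cong (H Y ++_) (++-identityʳ (h x)))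

  ¬m∣ˡ[] : ¬ m ∣ˡ []
  ¬m∣ˡ[] (q , eq) = m≢[] (++-conicalˡ m q eq)

  h≢[] : ∀ x → h x ≢ []
  h≢[] x eq = ¬m∣ˡ[] (subst (m ∣ˡ_) eq (m∣ˡh x))

  m∣ˡH∷ : ∀ x Y → m ∣ˡ H (x ∷ Y)
  m∣ˡH∷ x Y = x∣ˡy⇒x∣ˡyz (H Y) (m∣ˡh x)

  m∣ˡH : ∀ Y {w v} → H Y ≡ w ∷ v → m ∣ˡ H Y
  m∣ˡH (x ∷ Y) _ = m∣ˡH∷ x Y

  m∣ˡH-++ : ∀ Y {W} → m ∣ˡ W → m ∣ˡ (H Y ++ W)
  m∣ˡH-++ [] m∣ˡW = m∣ˡW
  m∣ˡH-++ (x ∷ Y) {W} _ = x∣ˡy⇒x∣ˡyz W (m∣ˡH∷ x Y)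

  length-H : ∀ Y → length m * length Y ≤ length (H Y)
  length-H [] = ≤-reflexive (*-zeroʳ (length m))
  length-H (x ∷ Y) = begin
    length m * suc (length Y)       ≡⟨ *-suc (length m) (length Y) ⟩
    length m + length m * length Y  ≤⟨ +-mono-≤ (length-∣ˡ (m∣ˡh x)) (length-H Y) ⟩
    length (h x) + length (H Y)     ≡⟨ length-++ (h x) ⟨
    length (H (x ∷ Y))              ∎
    where open ≤-Reasoning

  -- As H Y is empty or begins with m, a marker here would also be one inside h x · m.
  unmarked-inside : ∀ {x} u {z s} → u ≢ [] → h x ≡ u ++ z ∷ s → ∀ Y → ¬ m ∣ˡ (z ∷ s ++ H Y)
  unmarked-inside [] u≢[] _ _ _ = u≢[] refl
  unmarked-inside (y ∷ u) {z} {s} _ hx≡ [] m∣ˡ =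
    m-only-at-cuts hx≡ (x∣ˡy⇒x∣ˡyz m (subst (m ∣ˡ_) (++-identityʳ (z ∷ s)) m∣ˡ))
  unmarked-inside (y ∷ u) {z} {s} _ hx≡ (x′ ∷ Y) m∣ˡ =
    m-only-at-cuts hx≡ (∣ˡ-by-length m∣ˡ (x∣ˡy⇒zx∣ˡzy (z ∷ s) (m∣ˡH∷ x′ Y)) (length-suffix (z ∷ s) m))

  split-at-marker : ∀ Y u W → m ∣ˡ W → H Y ≡ u ++ W →
    ∃₂ λ Y₁ Y₂ → Y ≡ Y₁ ++ Y₂ × H Y₁ ≡ u × H Y₂ ≡ W
  split-at-marker [] u W m∣ˡW eq = ⊥-elim (¬m∣ˡ[] (subst (m ∣ˡ_) (++-conicalʳ u W (sym eq)) m∣ˡW))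
  split-at-marker (x ∷ Y) [] W _ eq = [] , x ∷ Y , refl , refl , eq
  split-at-marker (x ∷ Y) (y ∷ u) W m∣ˡW eq with ++-equidivisible (h x) (H Y) (y ∷ u) W eq
  ... | inj₂ (z , v , hx≡ , W≡) =
    ⊥-elim (unmarked-inside (y ∷ u) (λ ()) hx≡ Y (subst (m ∣ˡ_) (sym W≡) m∣ˡW))
  ... | inj₁ (v , yu≡ , HY≡) with split-at-marker Y v W m∣ˡW HY≡
  ...   | Y₁ , Y₂ , refl , refl , HY₂≡ = x ∷ Y₁ , Y₂ , refl , sym yu≡ , HY₂≡

  H-injective : ∀ Y Z → H Y ≡ H Z → Y ≡ Z
  H-injective [] [] _ = refl
  H-injective [] (z ∷ Z) eq = ⊥-elim (h≢[] z (++-conicalˡ (h z) (H Z) (sym eq)))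
  H-injective (y ∷ Y) [] eq = ⊥-elim (h≢[] y (++-conicalˡ (h y) (H Y) eq))
  H-injective (y ∷ Y) (z ∷ Z) eq with ++-equidivisible (h y) (H Y) (h z) (H Z) eq
  ... | inj₁ ([] , hz≡ , HY≡) =
    cong₂ _∷_ (h-injective (sym (trans hz≡ (++-identityʳ (h y))))) (H-injective Y Z HY≡)
  ... | inj₁ (w ∷ v , hz≡ , HY≡) =
    ⊥-elim (unmarked-inside (h y) (h≢[] y) hz≡ Z (subst (m ∣ˡ_) HY≡ (m∣ˡH Y HY≡)))
  ... | inj₂ (w , v , hy≡ , HZ≡) =
    ⊥-elim (unmarked-inside (h z) (h≢[] z) hy≡ Y (subst (m ∣ˡ_) (sym HZ≡) (m∣ˡH Z (sym HZ≡))))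

  H-prefix : ∀ Y R W → m ∣ˡ W → H Y ≡ H R ++ W → ∃ λ Y₃ → Y ≡ R ++ Y₃ × H Y₃ ≡ W
  H-prefix Y R W m∣ˡW eq with split-at-marker Y (H R) W m∣ˡW eq
  ... | Y₁ , Y₃ , refl , HY₁≡ , HY₃≡ = Y₃ , cong (_++ Y₃) (H-injective Y₁ R HY₁≡) , HY₃≡

  last-block : ∀ Y U t → t ≢ [] → length t ≤ length m → H Y ≡ U ++ t →
    ∃₂ λ Y₁ x → Y ≡ Y₁ ∷ʳ x × t ∣ʳ h x
  last-block Y U t t≢[] t≤m eq with initLast Y
  ... | [] = ⊥-elim (t≢[] (++-conicalʳ U t (sym eq)))
  ... | Y₁ ∷ʳ′ x = Y₁ , x , refl ,
    ∣ʳ-by-length (H Y₁) (h x) U t (trans (sym (H-∷ʳ Y₁ x)) eq) (≤-trans t≤m (length-∣ˡ (m∣ˡh x)))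

  desubstitute : ∀ Y U t R W → t ≢ [] → length t ≤ length m → m ∣ˡ W →
    H Y ≡ U ++ t ++ H R ++ W →
    ∃₂ λ Y₁ x → ∃ λ Y₃ → Y ≡ Y₁ ++ x ∷ R ++ Y₃ × t ∣ʳ h x × H Y₃ ≡ W
  desubstitute Y U t R W t≢[] t≤m m∣ˡW eq
    with split-at-marker Y (U ++ t) (H R ++ W) (m∣ˡH-++ R m∣ˡW) (trans eq (sym (++-assoc U t (H R ++ W))))
  ... | Y₁₂ , Y₃₊ , refl , HY₁₂≡ , HY₃₊≡
    with last-block Y₁₂ U t t≢[] t≤m HY₁₂≡ | H-prefix Y₃₊ R W m∣ˡW HY₃₊≡
  ... | Y₁ , x , refl , t∣ʳhx | Y₃ , refl , HY₃≡ =
    Y₁ , x , Y₃ , ++-assoc Y₁ (x ∷ []) (R ++ Y₃) , t∣ʳhx , HY₃≡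

retraction⇒injective : ∀ {X Y : Set} (to : X → Y) (from : Y → X) →
  StrictlyInverseʳ _≡_ to from → Injective _≡_ _≡_ to
retraction⇒injective to from retract = inverseʳ⇒injective {f⁻¹ = from} to (strictlyInverseʳ⇒inverseʳ to retract)

codeD : D → ℕ
codeD 𝟎 = 0
codeD 𝟏 = 1
codeD 𝟐 = 2
codeD 𝟑 = 3
codeD 𝟒 = 4

decodeD : ℕ → D
decodeD 0 = 𝟎
decodeD 1 = 𝟏
decodeD 2 = 𝟐
decodeD 3 = 𝟑
decodeD _ = 𝟒

decodeD-codeD : ∀ x → decodeD (codeD x) ≡ x
decodeD-codeD 𝟎 = refl
decodeD-codeD 𝟏 = refl
decodeD-codeD 𝟐 = refl
decodeD-codeD 𝟑 = refl
decodeD-codeD 𝟒 = refl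

_≟D_ : DecidableEquality D
_≟D_ = via-injection (mk↣ (retraction⇒injective codeD decodeD decodeD-codeD)) ℕ._≟_

codeL : L → ℕ
codeL a = 0
codeL b = 1
codeL c = 2
codeL d = 3
codeL e = 4

decodeL : ℕ → L
decodeL 0 = a
decodeL 1 = b
decodeL 2 = c
decodeL 3 = d
decodeL _ = e

decodeL-codeL : ∀ x → decodeL (codeL x) ≡ x
decodeL-codeL a = refl
decodeL-codeL b = refl
decodeL-codeL c = refl
decodeL-codeL d = refl
decodeL-codeL e = refl

_≟L_ : DecidableEquality L
_≟L_ = via-injection (mk↣ (retraction⇒injective codeL decodeL decodeL-codeL)) ℕ._≟_

f₁-starts-01 : ∀ x → (𝟎 ∷ 𝟏 ∷ []) ∣ˡ f₁ x
f₁-starts-01 𝟎 = _ , refl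
f₁-starts-01 𝟏 = _ , refl
f₁-starts-01 𝟐 = _ , refl
f₁-starts-01 𝟑 = _ , refl
f₁-starts-01 𝟒 = _ , refl

f₁-01-only-at-cuts : ∀ {x y u z s} → f₁ x ≡ y ∷ u ++ z ∷ s → ¬ (𝟎 ∷ 𝟏 ∷ []) ∣ˡ (z ∷ s ++ 𝟎 ∷ 𝟏 ∷ [])
f₁-01-only-at-cuts {x} {u = u} eq = no-marker-inside _≟D_ u (check x) (cong (drop 1) eq)
  where
  check : ∀ x → NoMarkerInside _≟D_ (𝟎 ∷ 𝟏 ∷ []) (drop 1 (f₁ x))
  check 𝟎 = _
  check 𝟏 = _
  check 𝟐 = _
  check 𝟑 = _
  check 𝟒 = _

f₁⁻¹ : List D → D
f₁⁻¹ (_ ∷ _ ∷ _ ∷ _ ∷ []) = 𝟏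
f₁⁻¹ (_ ∷ _ ∷ _ ∷ _ ∷ _ ∷ []) = 𝟎
f₁⁻¹ (_ ∷ _ ∷ _ ∷ _ ∷ _ ∷ _ ∷ _ ∷ []) = 𝟐
f₁⁻¹ (_ ∷ _ ∷ _ ∷ _ ∷ _ ∷ _ ∷ _ ∷ 𝟒 ∷ []) = 𝟑
f₁⁻¹ _ = 𝟒

f₁⁻¹-f₁ : ∀ x → f₁⁻¹ (f₁ x) ≡ x
f₁⁻¹-f₁ 𝟎 = refl
f₁⁻¹-f₁ 𝟏 = refl
f₁⁻¹-f₁ 𝟐 = refl
f₁⁻¹-f₁ 𝟑 = refl
f₁⁻¹-f₁ 𝟒 = refl

module F = Synchronizing f₁ (𝟎 ∷ 𝟏 ∷ []) (λ ()) f₁-starts-01 f₁-01-only-at-cuts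
  (retraction⇒injective f₁ f₁⁻¹ f₁⁻¹-f₁)

g₁-starts-abcd : ∀ x → (a ∷ b ∷ c ∷ d ∷ []) ∣ˡ g₁ x
g₁-starts-abcd 𝟎 = _ , refl
g₁-starts-abcd 𝟏 = _ , refl
g₁-starts-abcd 𝟐 = _ , refl
g₁-starts-abcd 𝟑 = _ , refl
g₁-starts-abcd 𝟒 = _ , refl

g₁-abcd-only-at-cuts : ∀ {x y u z s} → g₁ x ≡ y ∷ u ++ z ∷ s →
  ¬ (a ∷ b ∷ c ∷ d ∷ []) ∣ˡ (z ∷ s ++ a ∷ b ∷ c ∷ d ∷ [])
g₁-abcd-only-at-cuts {x} {u = u} eq = no-marker-inside _≟L_ u (check x) (cong (drop 1) eq)
  where
  check : ∀ x → NoMarkerInside _≟L_ (a ∷ b ∷ c ∷ d ∷ []) (drop 1 (g₁ x))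
  check 𝟎 = _
  check 𝟏 = _
  check 𝟐 = _
  check 𝟑 = _
  check 𝟒 = _

g₁⁻¹ : List L → D
g₁⁻¹ (_ ∷ _ ∷ _ ∷ _ ∷ e ∷ _ ∷ _ ∷ _ ∷ []) = 𝟎
g₁⁻¹ (_ ∷ _ ∷ _ ∷ _ ∷ _ ∷ _ ∷ _ ∷ _ ∷ []) = 𝟏
g₁⁻¹ (_ ∷ _ ∷ _ ∷ _ ∷ _ ∷ _ ∷ _ ∷ _ ∷ _ ∷ _ ∷ []) = 𝟐
g₁⁻¹ (_ ∷ _ ∷ _ ∷ _ ∷ _ ∷ _ ∷ _ ∷ _ ∷ _ ∷ _ ∷ _ ∷ _ ∷ _ ∷ _ ∷ []) = 𝟒
g₁⁻¹ _ = 𝟑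

g₁⁻¹-g₁ : ∀ x → g₁⁻¹ (g₁ x) ≡ x
g₁⁻¹-g₁ 𝟎 = refl
g₁⁻¹-g₁ 𝟏 = refl
g₁⁻¹-g₁ 𝟐 = refl
g₁⁻¹-g₁ 𝟑 = refl
g₁⁻¹-g₁ 𝟒 = refl

module G = Synchronizing g₁ (a ∷ b ∷ c ∷ d ∷ []) (λ ()) g₁-starts-abcd g₁-abcd-only-at-cuts
  (retraction⇒injective g₁ g₁⁻¹ g₁⁻¹-g₁)

data ZeroOrTwo : D → Set where
  is𝟎 : ZeroOrTwo 𝟎
  is𝟐 : ZeroOrTwo 𝟐

Not00or02 : D → D → Set
Not00or02 𝟎 𝟎 = ⊥
Not00or02 𝟎 𝟐 = ⊥
Not00or02 _ _ = ⊤

f-Not00or02 : ∀ Y → Linked Not00or02 (f Y)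
f-Not00or02 [] = []
f-Not00or02 (x ∷ Y) = block x (f-Not00or02 Y)
  where
  ∷-after : ∀ {x w} → (∀ {y} → Not00or02 x y) → Linked Not00or02 w → Linked Not00or02 (x ∷ w)
  ∷-after r [] = [-]
  ∷-after r [-] = r ∷ [-]
  ∷-after r (q ∷ qs) = r ∷ q ∷ qs

  block : ∀ x {w} → Linked Not00or02 w → Linked Not00or02 (f₁ x ++ w)
  block 𝟎 lw = _ ∷ _ ∷ _ ∷ _ ∷ ∷-after _ lw
  block 𝟏 lw = _ ∷ _ ∷ _ ∷ ∷-after _ lw
  block 𝟐 lw = _ ∷ _ ∷ _ ∷ _ ∷ _ ∷ _ ∷ ∷-after _ lw
  block 𝟑 lw = _ ∷ _ ∷ _ ∷ _ ∷ _ ∷ _ ∷ _ ∷ ∷-after _ lw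
  block 𝟒 lw = _ ∷ _ ∷ _ ∷ _ ∷ _ ∷ _ ∷ _ ∷ ∷-after _ lw

f-no-0z : ∀ Y U {z} V → ZeroOrTwo z → f Y ≢ U ++ 𝟎 ∷ z ∷ V
f-no-0z Y U V z∈ eq with Linked.head (Linked-drop U (subst (Linked Not00or02) eq (f-Not00or02 Y))) | z∈
... | () | is𝟎
... | () | is𝟐

-- Reversal turns the unknown part of the block into a tail, so unification reads off its last letters.
f₁-ending-x3 : ∀ {x} y → x ≢ 𝟐 → (x ∷ 𝟑 ∷ []) ∣ʳ f₁ y → y ≡ 𝟎
f₁-ending-x3 y x≢2 x3∣ʳ with y | ∣ʳ⇒reverse-∣ˡ x3∣ʳ
... | 𝟎 | _ = refl
... | 𝟏 | _ , ()
... | 𝟐 | _ , refl = ⊥-elim (x≢2 refl)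
... | 𝟑 | _ , ()
... | 𝟒 | _ , refl = ⊥-elim (x≢2 refl)

f-beginning-0120 : ∀ {z V} Y → f Y ≡ 𝟎 ∷ 𝟏 ∷ 𝟐 ∷ z ∷ V → ZeroOrTwo z →
  ∃₂ λ y Y′ → Y ≡ y ∷ Y′ × ZeroOrTwo y
f-beginning-0120 (𝟎 ∷ Y) _ _ = 𝟎 , Y , refl , is𝟎
f-beginning-0120 (𝟐 ∷ Y) _ _ = 𝟐 , Y , refl , is𝟐
f-beginning-0120 (𝟏 ∷ Y) refl ()
f-beginning-0120 (𝟑 ∷ Y) refl ()
f-beginning-0120 (𝟒 ∷ Y) refl ()

g₁-ending-d : ∀ {x} → (d ∷ []) ∣ʳ g₁ x → x ≢ 𝟐
g₁-ending-d d∣ʳ refl with ∣ʳ⇒reverse-∣ˡ d∣ʳ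
... | _ , ()

abcdeac : List L
abcdeac = a ∷ b ∷ c ∷ d ∷ e ∷ a ∷ c ∷ []

g-beginning-abcdeac : ∀ {V} Y → g Y ≡ abcdeac ++ V →
  ∃₂ λ y Y′ → Y ≡ y ∷ Y′ × ZeroOrTwo y
g-beginning-abcdeac (𝟎 ∷ Y) _ = 𝟎 , Y , refl , is𝟎
g-beginning-abcdeac (𝟐 ∷ Y) _ = 𝟐 , Y , refl , is𝟐
g-beginning-abcdeac (𝟏 ∷ Y) ()
g-beginning-abcdeac (𝟑 ∷ Y) ()
g-beginning-abcdeac (𝟒 ∷ Y) ()

f-++ : ∀ Y Z → f (Y ++ Z) ≡ f Y ++ f Z
f-++ = concatMap-++ f₁

g-++ : ∀ Y Z → g (Y ++ Z) ≡ g Y ++ g Z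
g-++ = concatMap-++ g₁

𝟎𝟏𝟐 : List D
𝟎𝟏𝟐 = 𝟎 ∷ 𝟏 ∷ 𝟐 ∷ []

Tpre : ℕ → List D
Tpre zero = []
Tpre (suc k) = 𝟑 ∷ f (Tpre k) ++ 𝟎𝟏𝟐

pWord-suc : ∀ k → pWord (suc k) ≡ 𝟑 ∷ f (pWord k)
pWord-suc zero = refl
pWord-suc (suc k) = trans (cong (_++ fpow (2 + k) (𝟑 ∷ [])) (pWord-suc k))
                          (cong (𝟑 ∷_) (sym (f-++ (pWord k) (fpow (suc k) (𝟑 ∷ [])))))

sWord-suc : ∀ k → sWord (suc k) ≡ f (sWord k) ++ 𝟎𝟏𝟐
sWord-suc zero = refl
sWord-suc (suc k) = begin
  fpow (2 + k) 𝟎𝟏𝟐 ++ sWord (suc k)               ≡⟨ cong (fpow (2 + k) 𝟎𝟏𝟐 ++_) (sWord-suc k) ⟩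
  f (fpow (suc k) 𝟎𝟏𝟐) ++ (f (sWord k) ++ 𝟎𝟏𝟐)    ≡⟨ ++-assoc (f (fpow (suc k) 𝟎𝟏𝟐)) (f (sWord k)) 𝟎𝟏𝟐 ⟨
  (f (fpow (suc k) 𝟎𝟏𝟐) ++ f (sWord k)) ++ 𝟎𝟏𝟐    ≡⟨ cong (_++ 𝟎𝟏𝟐) (f-++ (fpow (suc k) 𝟎𝟏𝟐) (sWord k)) ⟨
  f (sWord (suc k)) ++ 𝟎𝟏𝟐                        ∎
  where open ≡-Reasoning

pWord-++-sWord : ∀ k → pWord k ++ sWord k ≡ Tpre (suc k)
pWord-++-sWord zero = refl
pWord-++-sWord (suc k) = begin
  pWord (suc k) ++ sWord (suc k)              ≡⟨ cong₂ _++_ (pWord-suc k) (sWord-suc k) ⟩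
  𝟑 ∷ f (pWord k) ++ (f (sWord k) ++ 𝟎𝟏𝟐)     ≡⟨ cong (𝟑 ∷_) (++-assoc (f (pWord k)) (f (sWord k)) 𝟎𝟏𝟐) ⟨
  𝟑 ∷ (f (pWord k) ++ f (sWord k)) ++ 𝟎𝟏𝟐     ≡⟨ cong (λ w → 𝟑 ∷ w ++ 𝟎𝟏𝟐) (f-++ (pWord k) (sWord k)) ⟨
  𝟑 ∷ f (pWord k ++ sWord k) ++ 𝟎𝟏𝟐           ≡⟨ cong (λ w → 𝟑 ∷ f w ++ 𝟎𝟏𝟐) (pWord-++-sWord k) ⟩
  Tpre (2 + k)                                ∎
  where open ≡-Reasoning

T01203-Tpre : ∀ k → T01203 k ≡ d ∷ g (Tpre (suc k)) ++ abcdeac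
T01203-Tpre k = cong (d ∷_) (begin
  g (pWord k) ++ (g (sWord k) ++ abcdeac)   ≡⟨ ++-assoc (g (pWord k)) (g (sWord k)) abcdeac ⟨
  (g (pWord k) ++ g (sWord k)) ++ abcdeac   ≡⟨ cong (_++ abcdeac) (g-++ (pWord k) (sWord k)) ⟨
  g (pWord k ++ sWord k) ++ abcdeac         ≡⟨ cong (λ w → g w ++ abcdeac) (pWord-++-sWord k) ⟩
  g (Tpre (suc k)) ++ abcdeac               ∎)
  where open ≡-Reasoning

fpow-01203 : ∀ k → fpow k (𝟎 ∷ 𝟏 ∷ 𝟐 ∷ 𝟎 ∷ 𝟑 ∷ []) ≡ sWord k ++ 𝟎 ∷ pWord k
fpow-01203 zero = refl
fpow-01203 (suc k) = begin
  f (fpow k (𝟎 ∷ 𝟏 ∷ 𝟐 ∷ 𝟎 ∷ 𝟑 ∷ []))                      ≡⟨ cong f (fpow-01203 k) ⟩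
  f (sWord k ++ 𝟎 ∷ pWord k)                               ≡⟨ f-++ (sWord k) (𝟎 ∷ pWord k) ⟩
  f (sWord k) ++ 𝟎 ∷ 𝟏 ∷ 𝟐 ∷ 𝟎 ∷ 𝟑 ∷ f (pWord k)            ≡⟨ ++-assoc (f (sWord k)) 𝟎𝟏𝟐 _ ⟨
  (f (sWord k) ++ 𝟎𝟏𝟐) ++ 𝟎 ∷ 𝟑 ∷ f (pWord k)              ≡⟨ cong₂ (λ s p → s ++ 𝟎 ∷ p) (sWord-suc k) (pWord-suc k) ⟨
  sWord (suc k) ++ 𝟎 ∷ pWord (suc k)                       ∎
  where open ≡-Reasoning

T01203-conjugate : ∀ k → Conjugate (T01203 k) (g (fpow k (𝟎 ∷ 𝟏 ∷ 𝟐 ∷ 𝟎 ∷ 𝟑 ∷ [])))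
T01203-conjugate k = s01203 k , p01203 k , g-01203 , refl
  where
  g-01203 : g (fpow k (𝟎 ∷ 𝟏 ∷ 𝟐 ∷ 𝟎 ∷ 𝟑 ∷ [])) ≡ s01203 k ++ p01203 k
  g-01203 = trans (cong g (fpow-01203 k))
                  (trans (g-++ (sWord k) (𝟎 ∷ pWord k)) (sym (++-assoc (g (sWord k)) abcdeac (p01203 k))))

f-desubstitute : ∀ k Y U {x z} V → x ≢ 𝟐 → ZeroOrTwo z → f Y ≡ U ++ x ∷ Tpre (suc k) ++ z ∷ V →
  ∃₂ λ U′ z′ → ∃ λ V′ → Y ≡ U′ ++ 𝟎 ∷ Tpre k ++ z′ ∷ V′ × ZeroOrTwo z′
f-desubstitute k Y U {x} {z} V x≢2 z∈ eq
  with F.desubstitute Y U (x ∷ 𝟑 ∷ []) (Tpre k) (𝟎 ∷ 𝟏 ∷ 𝟐 ∷ z ∷ V) (λ ()) ≤-refl (_ , refl)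
         (trans eq (cong (λ w → U ++ x ∷ 𝟑 ∷ w) (++-assoc (f (Tpre k)) 𝟎𝟏𝟐 (z ∷ V))))
... | Y₁ , y , Y₃ , refl , x3∣ʳ , fY₃≡ with f₁-ending-x3 y x≢2 x3∣ʳ | f-beginning-0120 Y₃ fY₃≡ z∈
... | refl | z′ , Y₃′ , refl , z′∈ = Y₁ , z′ , Y₃′ , refl , z′∈

g-desubstitute : ∀ k Y U V → g Y ≡ U ++ T01203 k ++ V →
  ∃₂ λ U′ x → ∃₂ λ z V′ → Y ≡ U′ ++ x ∷ Tpre (suc k) ++ z ∷ V′ × x ≢ 𝟐 × ZeroOrTwo z
g-desubstitute k Y U V eq
  with G.desubstitute Y U (d ∷ []) (Tpre (suc k)) (abcdeac ++ V) (λ ()) (s≤s z≤n) (_ , refl)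
         (trans eq (cong (U ++_) (trans (cong (_++ V) (T01203-Tpre k))
                                        (cong (d ∷_) (++-assoc (g (Tpre (suc k))) abcdeac V)))))
... | Y₁ , x , Y₃ , refl , d∣ʳ , gY₃≡ with g-beginning-abcdeac Y₃ gY₃≡
... | z , Y₃′ , refl , z∈ = Y₁ , x , z , Y₃′ , refl , g₁-ending-d d∣ʳ , z∈

no-0-Tpre-z : ∀ k Y U {z} V → ZeroOrTwo z → fpow (suc k) Y ≢ U ++ 𝟎 ∷ Tpre k ++ z ∷ V
no-0-Tpre-z zero Y U V z∈ = f-no-0z Y U V z∈
no-0-Tpre-z (suc k) Y U V z∈ eq with f-desubstitute k (fpow (suc k) Y) U V (λ ()) z∈ eq
... | U′ , _ , V′ , eq′ , z′∈ = no-0-Tpre-z k Y U′ V′ z′∈ eq′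

T01203-not-in-image : ∀ k Y U V → g (fpow (2 + k) Y) ≢ U ++ T01203 k ++ V
T01203-not-in-image k Y U V eq with g-desubstitute k _ U V eq
... | U′ , x , z , V′ , eq′ , x≢2 , z∈ with f-desubstitute k (fpow (suc k) Y) U′ V′ x≢2 z∈ eq′
... | U″ , _ , V″ , eq″ , z′∈ = no-0-Tpre-z k Y U″ V″ z′∈ eq″

fⁿ𝟎 : ℕ → List D
fⁿ𝟎 n = fpow n (𝟎 ∷ [])

fpow-+ : ∀ m n w → fpow (m + n) w ≡ fpow m (fpow n w)
fpow-+ zero n w = refl
fpow-+ (suc m) n w = cong f (fpow-+ m n w)

fⁿ𝟎-∣ˡ-suc : ∀ n → fⁿ𝟎 n ∣ˡ fⁿ𝟎 (suc n)
fⁿ𝟎-∣ˡ-suc zero = _ , refl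
fⁿ𝟎-∣ˡ-suc (suc n) = concatMap-∣ˡ f₁ (fⁿ𝟎-∣ˡ-suc n)

fⁿ𝟎-mono : ∀ {m n} → m ≤ n → fⁿ𝟎 m ∣ˡ fⁿ𝟎 n
fⁿ𝟎-mono = mono′ ∘ ≤⇒≤′
  where
  mono′ : ∀ {m n} → m ≤′ n → fⁿ𝟎 m ∣ˡ fⁿ𝟎 n
  mono′ ≤′-refl = ∣ˡ-refl
  mono′ (≤′-step {n} m≤′n) = ∣ˡ-trans (mono′ m≤′n) (fⁿ𝟎-∣ˡ-suc n)

length-fⁿ𝟎 : ∀ n → n < length (fⁿ𝟎 n)
length-fⁿ𝟎 zero = s≤s z≤n
length-fⁿ𝟎 (suc n) = begin
  2 + n                  ≤⟨ +-mono-≤ (≤-trans (s≤s z≤n) IH) (≤-trans IH (m≤m+n _ 0)) ⟩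
  2 * length (fⁿ𝟎 n)     ≤⟨ F.length-H (fⁿ𝟎 n) ⟩
  length (fⁿ𝟎 (suc n))   ∎
  where
  open ≤-Reasoning
  IH = length-fⁿ𝟎 n

length-g : ∀ Y → length Y ≤ length (g Y)
length-g Y = ≤-trans (m≤n*m (length Y) 4) (G.length-H Y)

fω-lookup : ∀ {j N} → j < N → fω j ≡ lookupD 𝟎 (fⁿ𝟎 N) j
fω-lookup {j} j<N = sym (lookupD-∣ˡ 𝟎 j (<-trans (n<1+n j) (length-fⁿ𝟎 (suc j))) (fⁿ𝟎-mono j<N))

w₅-lookup : ∀ {j N} → j < N → w₅ j ≡ lookupD a (g (fⁿ𝟎 N)) j
w₅-lookup {j} {N} j<N = begin
  lookupD a (g (map fω (upTo (suc j)))) j   ≡⟨ cong (λ w → lookupD a (g w) j) (map-upTo fω (suc j)) ⟩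
  lookupD a (g (applyUpTo fω (suc j))) j    ≡⟨ lookupD-∣ˡ a j j<g (concatMap-∣ˡ g₁ prefix-fⁿ𝟎) ⟨
  lookupD a (g (fⁿ𝟎 N)) j                   ∎
  where
  open ≡-Reasoning
  prefix-fⁿ𝟎 : applyUpTo fω (suc j) ∣ˡ fⁿ𝟎 N
  prefix-fⁿ𝟎 = applyUpTo-∣ˡ 𝟎 fω (suc j) (fⁿ𝟎 N) (≤-trans j<N (<⇒≤ (length-fⁿ𝟎 N)))
                 (λ i<1+j → fω-lookup (≤-trans i<1+j j<N))
  j<g : j < length (g (applyUpTo fω (suc j)))
  j<g = ≤-trans (≤-reflexive (sym (length-applyUpTo fω (suc j)))) (length-g (applyUpTo fω (suc j)))

w₅-prefix : ∀ {n N} → n ≤ N → applyUpTo w₅ n ∣ˡ g (fⁿ𝟎 N)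
w₅-prefix {n} {N} n≤N =
  applyUpTo-∣ˡ a w₅ n (g (fⁿ𝟎 N)) (≤-trans n≤N (≤-trans (<⇒≤ (length-fⁿ𝟎 N)) (length-g (fⁿ𝟎 N))))
    (λ j<n → w₅-lookup (≤-trans j<n n≤N))

mainTheorem6 : (k : ℕ) →
    Conjugate (T01203 k) (g (fpow k (𝟎 ∷ 𝟏 ∷ 𝟐 ∷ 𝟎 ∷ 𝟑 ∷ [])))
      × ¬ FactorOf (T01203 k) w₅
mainTheorem6 k = T01203-conjugate k , not-factor
  where
  not-factor : ¬ FactorOf (T01203 k) w₅
  not-factor occurrence with factor⇒suffix-of-prefix occurrence
  ... | n , U , prefix≡ with w₅-prefix (m≤n+m n (2 + k))
  ... | V , image≡ = T01203-not-in-image k (fⁿ𝟎 n) U V (begin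
    g (fpow (2 + k) (fⁿ𝟎 n))   ≡⟨ cong g (fpow-+ (2 + k) n (𝟎 ∷ [])) ⟨
    g (fⁿ𝟎 (2 + k + n))        ≡⟨ image≡ ⟨
    applyUpTo w₅ n ++ V        ≡⟨ cong (_++ V) prefix≡ ⟩
    (U ++ T01203 k) ++ V       ≡⟨ ++-assoc U (T01203 k) V ⟩
    U ++ T01203 k ++ V         ∎)
    where open ≡-Reasoning
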